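{- Let $\mathbb F$ be a finite field, $n\ge4$ an integer, and let $\mathcal C_0\subseteq\mathbb F^{(n-1)\times(n-1)}$ be an $[(n-1)\times(n-1),(n-1)(n-3),3]_{\mathbb F}$ MRD code, viewed inside $\mathbb F^{n\times n}$ by placing each matrix in the top-left $(n-1)\times(n-1)$ block and padding with zeros. Let $\mathcal C_0'\subseteq\mathbb F^{(n-2)\times(n-2)}$ be the set of matrices obtained from the elements of $\mathcal C_0$ (as $(n-1)\times(n-1)$ matrices) by deleting the first row and first column, let $A'\in\mathbb F^{(n-2)\times(n-2)}\setminus\mathcal C_0'$, and let $A\in\mathbb F^{n\times n}$ be defined by $A_{i,j}=1$ if $(i,j)\in\{(1,n),(n,1)\}$, $A_{i,j}=A'_{i-1,j-1}$ if $2\le i,j\le n-1$, and $A_{i,j}=0$ otherwise. Then $\mathcal C_0\oplus\langle A\rangle_{\mathbb F}$ is a $[\mathcal G_n,\nu_{\min}(\mathcal G_n,3),3]_{\mathbb F}$ MFD code (and $\nu_{\min}(\mathcal G_n,3)=(n-2)^2$).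
   Context: A Ferrers diagram is a finite $\mathcal D\subseteq\mathbb N^2$ ($\mathbb N=\{1,2,\dots\}$) with $(x,y)\in\mathcal D\Rightarrow(i,j)\in\mathcal D$ for all $1\le i\le x$, $1\le j\le y$ (row, column). $\mathcal G_n$ is the Ferrers diagram with column heights $(n,\underbrace{n-1,\dots,n-1}_{n-2},1)$. For $\mathcal D\subseteq[n]^2$, $\mathbb F^{\mathcal D}=\{M\in\mathbb F^{n\times n}: m_{ij}=0\text{ for }(i,j)\notin\mathcal D\}$; a $[\mathcal D,k,d]_{\mathbb F}$ code is a $k$-dimensional subspace of $\mathbb F^{\mathcal D}$ whose nonzero elements have minimum rank exactly $d$. $\nu_j(\mathcal D,d)=|\{(x,y)\in\mathcal D:x\ge d-j,\ y\ge j+1\}|$ for $0\le j\le d-1$, $\nu_{\min}(\mathcal D,d)=\min_j\nu_j(\mathcal D,d)$; an MFD code is a $[\mathcal D,\nu_{\min}(\mathcal D,d),d]_{\mathbb F}$ code. An $[m\times n,k,d]_{\mathbb F}$ code is a $[[m]\times[n],k,d]_{\mathbb F}$ code; it is MRD if $k=\max(m,n)(\min(m,n)-d+1)$. -}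

module Defs where

open import Level using (Level; _⊔_) renaming (suc to lsuc)
open import Data.Nat using () renaming (_⊔_ to _⊔ℕ_; _+_ to _+ℕ_; _*_ to _*ℕ_)
open import Algebra.Bundles using (CommutativeRing)
open import Data.Nat using (ℕ; zero; suc; _∸_; _⊓_; _<?_; _≤_; _≡ᵇ_; _≤ᵇ_)
open import Data.Bool using (Bool; true; false; _∧_; _∨_; if_then_else_)
open import Data.Fin using (Fin; toℕ; fromℕ<)
open import Data.List using (List; []; _∷_; map; foldr; applyUpTo; upTo; concatMap)
open import Data.List.Relation.Unary.Any using (Any)
open import Data.Nat.ListAction using (sum)
open import Data.Product using (Σ; ∃; _×_; _,_)
open import Relation.Nullary using (¬_; yes; no)
open import Relation.Binary using (Decidable)
open import Relation.Binary.PropositionalEquality using (_≡_)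

record FiniteField (c ℓ : Level) : Set (lsuc (c ⊔ ℓ)) where
  field
    commutativeRing : CommutativeRing c ℓ
  open CommutativeRing commutativeRing public
  field
    0≉1      : ¬ (0# ≈ 1#)
    inverse  : ∀ x → ¬ (x ≈ 0#) → ∃ λ y → x * y ≈ 1#
    _≟_      : Decidable _≈_
    elements : List Carrier
    complete : ∀ x → Any (x ≈_) elements

-- Ferrers-type diagrams, given by their (1-based) membership test.
-- (x , y) = (row , column).

Diagram : Set
Diagram = ℕ → ℕ → Bool

rect : ℕ → ℕ → Diagram
rect m n x y = (1 ≤ᵇ x) ∧ (x ≤ᵇ m) ∧ (1 ≤ᵇ y) ∧ (y ≤ᵇ n)

heightG : ℕ → ℕ → ℕ
heightG n y = if y ≡ᵇ 1 then n else (if y ≡ᵇ n then 1 else n ∸ 1)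

G : ℕ → Diagram
G n x y = (1 ≤ᵇ y) ∧ (y ≤ᵇ n) ∧ (1 ≤ᵇ x) ∧ (x ≤ᵇ heightG n y)

nu : ℕ → Diagram → ℕ → ℕ → ℕ
nu n D d j =
  sum (concatMap (λ x → map (λ y →
         if D x y ∧ ((d ∸ j) ≤ᵇ x) ∧ ((j +ℕ 1) ≤ᵇ y) then 1 else 0)
       (applyUpTo suc n)) (applyUpTo suc n))

nuMin : ℕ → Diagram → ℕ → ℕ
nuMin n D zero    = 0
nuMin n D (suc e) = foldr _⊓_ (nu n D (suc e) 0) (map (nu n D (suc e)) (upTo (suc e)))

module LA {c ℓ : Level} (F : FiniteField c ℓ) where
  open FiniteField F

  Mat : ℕ → ℕ → Set c
  Mat a b = Fin a → Fin b → Carrier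

  sumF : ∀ {k} → (Fin k → Carrier) → Carrier
  sumF {zero}  f = 0#
  sumF {suc k} f = f Fin.zero + sumF (λ t → f (Fin.suc t))
    where import Data.Fin as Fin

  LinIndep : ∀ {k m} → (Fin k → Fin m → Carrier) → Set (c ⊔ ℓ)
  LinIndep {k} {m} v =
    ∀ (α : Fin k → Carrier) →
      (∀ i → sumF (λ t → α t * v t i) ≈ 0#) → ∀ t → α t ≈ 0#

  HasRank : ∀ {a b} → Mat a b → ℕ → Set (c ⊔ ℓ)
  HasRank {a} {b} M r =
    (∃ λ (s : Fin r → Fin b) → LinIndep (λ t i → M i (s t))) ×
    (∀ (s : Fin (suc r) → Fin b) → ¬ LinIndep (λ t i → M i (s t)))

  IsZero : ∀ {a b} → Mat a b → Set ℓ
  IsZero M = ∀ i j → M i j ≈ 0#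

  LinIndepMat : ∀ {k a b} → (Fin k → Mat a b) → Set (c ⊔ ℓ)
  LinIndepMat {k} B =
    ∀ (α : Fin k → Carrier) →
      (∀ i j → sumF (λ t → α t * B t i j) ≈ 0#) → ∀ t → α t ≈ 0#

  InSpan : ∀ {k a b} → (Fin k → Mat a b) → Mat a b → Set (c ⊔ ℓ)
  InSpan {k} B M = ∃ λ (α : Fin k → Carrier) →
    ∀ i j → M i j ≈ sumF (λ t → α t * B t i j)

  InDiag : ∀ {a b} → Diagram → Mat a b → Set ℓ
  InDiag D M = ∀ i j → D (suc (toℕ i)) (suc (toℕ j)) ≡ false → M i j ≈ 0#

  MinRankExactly : ∀ {a b ℓ'} → ℕ → (Mat a b → Set ℓ') → Set (c ⊔ ℓ ⊔ ℓ')
  MinRankExactly d C =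
    (∀ M → C M → ¬ IsZero M → ∃ λ r → HasRank M r × (d ≤ r)) ×
    (∃ λ M → C M × ¬ IsZero M × HasRank M d)

  IsCode : ∀ {a b ℓ'} → Diagram → ℕ → ℕ → (Mat a b → Set ℓ') → Set (c ⊔ ℓ ⊔ ℓ')
  IsCode {a} {b} D k d C =
    (∃ λ (B : Fin k → Mat a b) → LinIndepMat B ×
       (∀ M → C M → InSpan B M) × (∀ M → InSpan B M → C M)) ×
    (∀ M → C M → InDiag D M) ×
    MinRankExactly d C

  IsMRD : ∀ {ℓ'} (m n d : ℕ) → (Mat m n → Set ℓ') → Set (c ⊔ ℓ ⊔ ℓ')
  IsMRD m n d C = IsCode (rect m n) ((m ⊔ℕ n) *ℕ ((m ⊓ n) ∸ d +ℕ 1)) d C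

  -- 1-based entry access, returning 0 outside [a] × [b]
  entry : ∀ {a b} → Mat a b → ℕ → ℕ → Carrier
  entry M zero y = 0#
  entry M (suc x) zero = 0#
  entry {a} {b} M (suc x) (suc y) with x <? a | y <? b
  ... | yes p | yes q = M (fromℕ< p) (fromℕ< q)
  ... | _     | _     = 0#

  pad : ∀ {a b} (n : ℕ) → Mat a b → Mat n n
  pad n M i j = entry M (suc (toℕ i)) (suc (toℕ j))

  delFirst : ∀ {a b} (m : ℕ) → Mat a b → Mat m m
  delFirst m M i j = entry M (2 +ℕ toℕ i) (2 +ℕ toℕ j)

  Amat : ∀ {m} (n : ℕ) → Mat m m → Mat n n
  Amat n A' i j =
    if ((x ≡ᵇ 1) ∧ (y ≡ᵇ n)) ∨ ((x ≡ᵇ n) ∧ (y ≡ᵇ 1))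
      then 1#
      else (if (2 ≤ᵇ x) ∧ (x ≤ᵇ n ∸ 1) ∧ (2 ≤ᵇ y) ∧ (y ≤ᵇ n ∸ 1)
              then entry A' (x ∸ 1) (y ∸ 1) else 0#)
    where
      x = suc (toℕ i)
      y = suc (toℕ j)

  SumCode : ∀ {a b ℓ'} (n : ℕ) → (Mat a b → Set ℓ') → Mat n n → Mat n n → Set (c ⊔ ℓ ⊔ ℓ')
  SumCode n C₀ A X = ∃ λ M → ∃ λ λ' → C₀ M × (∀ i j → X i j ≈ pad n M i j + λ' * A i j)

module Submission where

-- Counting: ν_j(G_n, 3) is the sum, over the columns y > j of G_n, of min(n, h_y) − (2 − j), where
-- h_y is the height of column y; for each j ∈ {0, 1, 2} this is (n − 2)².
--
-- The code: A has the entry 1 at (n, 1), where every padded element of C₀ vanishes, so A together with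
-- a padded basis of C₀ is a basis of C₀ ⊕ ⟨A⟩, and all of these vanish outside G_n. A codeword
-- X = M + λA with λ = 0 has the rank of M, which is at least 3. If λ ≠ 0, the block of X in rows and
-- columns 2, …, n − 1 is M′ + λA′, where M′ is M without its first row and column; it is nonzero since
-- A′ ∉ C₀′. A nonzero entry (p, q) of it puts the columns 1, q, n of X in echelon form, with pivots in
-- rows n, p, 1, so rank X ≥ 3. Padding a rank-3 element of C₀ gives a codeword of rank exactly 3.
-- Ranks exist at all because linear independence over a finite field is decidable, by enumerating
-- the finitely many coefficient vectors.

open import Defs
open import Level using (Level; _⊔_)
open import Function using (_∘_; _∘₂_)
open import Data.Bool using (true; false; _∧_; if_then_else_)
open import Data.List using (List)
open import Data.Fin using (Fin; zero; suc; toℕ; fromℕ; fromℕ<; inject₁; inject≤)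
import Data.Fin.Properties as Fin
open import Data.List.Relation.Unary.Any as Any using (Any)
open import Data.Vec.Functional using (Vector; []; _∷_; head; tail)
open import Data.Nat as ℕ
  using (ℕ; zero; suc; pred; _≤_; _<_; _≮_; _≰_; _∸_; _⊓_; _≤ᵇ_; _<ᵇ_; _≡ᵇ_; s≤s; z≤n; s<s; z<s)
open import Data.Product using (∃; _×_; _,_)
open import Relation.Nullary using (¬_)
open import Relation.Nullary.Decidable using (Dec; yes; no; does; map′; dec-true; dec-false)
open import Relation.Binary.PropositionalEquality using (_≡_; _≢_)

module BooleanComparisons where

  open import Data.Nat.Properties using (≤ᵇ-reflects-≤; <ᵇ-reflects-<; ≡ᵇ⇒≡; ≡⇒≡ᵇ)
  open import Relation.Binary.PropositionalEquality using (refl)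
  open import Relation.Nullary.Reflects using (Reflects; ofʸ; ofⁿ; det; fromEquivalence)

  ≡ᵇ-reflects-≡ : ∀ m n → Reflects (m ≡ n) (m ≡ᵇ n)
  ≡ᵇ-reflects-≡ m n = fromEquivalence (≡ᵇ⇒≡ m n) (≡⇒≡ᵇ m n)

  ≡ᵇ-refl : ∀ n → (n ≡ᵇ n) ≡ true
  ≡ᵇ-refl n = det (≡ᵇ-reflects-≡ n n) (ofʸ refl)

  ≡ᵇ-false : ∀ {m n} → m ≢ n → (m ≡ᵇ n) ≡ false
  ≡ᵇ-false = det (≡ᵇ-reflects-≡ _ _) ∘ ofⁿ

  <ᵇ-true : ∀ {m n} → m < n → (m <ᵇ n) ≡ true
  <ᵇ-true = det (<ᵇ-reflects-< _ _) ∘ ofʸ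

  <ᵇ-false : ∀ {m n} → m ≮ n → (m <ᵇ n) ≡ false
  <ᵇ-false = det (<ᵇ-reflects-< _ _) ∘ ofⁿ

  ≤ᵇ-true : ∀ {m n} → m ≤ n → (m ≤ᵇ n) ≡ true
  ≤ᵇ-true = det (≤ᵇ-reflects-≤ _ _) ∘ ofʸ

  ≤ᵇ-false : ∀ {m n} → m ≰ n → (m ≤ᵇ n) ≡ false
  ≤ᵇ-false = det (≤ᵇ-reflects-≤ _ _) ∘ ofⁿ

module FerrersDiagrams where

  open BooleanComparisons
  open import Relation.Binary.PropositionalEquality using (refl; sym; trans; cong; cong₂; module ≡-Reasoning)
  open import Data.List using ([]; _∷_; map; concatMap; applyUpTo)
  open import Data.Nat using (_+_; _*_)
  open import Data.Nat.Properties
    using (+-comm; +-assoc; +-identityʳ; 0∸n≡0; _≤?_; <⇒≤; ≤-trans; ≤-pred; n≤1+n; ≰⇒>; pred-mono-≤;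
           m≤n⇒m⊓n≡m; m≥n⇒m⊓n≡n; m≤n⇒m∸n≡0; +-∸-assoc)
  open import Data.Nat.ListAction using (sum)
  open import Data.Nat.ListAction.Properties using (sum-++)
  open import Data.Nat.Tactic.RingSolver using (solve-∀)

  sumTo : ℕ → (ℕ → ℕ) → ℕ
  sumTo zero    f = 0
  sumTo (suc n) f = f 0 + sumTo n (f ∘ suc)

  sum-map-applyUpTo : ∀ {A : Set} (f : ℕ → A) (g : A → ℕ) n →
    sum (map g (applyUpTo f n)) ≡ sumTo n (g ∘ f)
  sum-map-applyUpTo f g zero    = refl
  sum-map-applyUpTo f g (suc n) = cong (g (f 0) +_) (sum-map-applyUpTo (f ∘ suc) g n)

  sum-concatMap : ∀ {A : Set} (f : A → List ℕ) xs → sum (concatMap f xs) ≡ sum (map (sum ∘ f) xs)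
  sum-concatMap f []       = refl
  sum-concatMap f (x ∷ xs) = trans (sum-++ (f x) (concatMap f xs)) (cong (sum (f x) +_) (sum-concatMap f xs))

  sumTo-cong : ∀ n {f g} → (∀ i → i < n → f i ≡ g i) → sumTo n f ≡ sumTo n g
  sumTo-cong zero    f≡g = refl
  sumTo-cong (suc n) f≡g = cong₂ _+_ (f≡g 0 z<s) (sumTo-cong n (λ i i<n → f≡g (suc i) (s<s i<n)))

  sumTo-zero : ∀ n → sumTo n (λ _ → 0) ≡ 0
  sumTo-zero zero    = refl
  sumTo-zero (suc n) = sumTo-zero n

  sumTo-const : ∀ n c → sumTo n (λ _ → c) ≡ n * c
  sumTo-const zero    c = refl
  sumTo-const (suc n) c = cong (c +_) (sumTo-const n c)

  sumTo-+ : ∀ n (f g : ℕ → ℕ) → sumTo n (λ i → f i + g i) ≡ sumTo n f + sumTo n g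
  sumTo-+ zero    f g = refl
  sumTo-+ (suc n) f g = trans (cong (f 0 + g 0 +_) (sumTo-+ n (f ∘ suc) (g ∘ suc))) (interchange (f 0) (g 0) _ _)
    where
    interchange : ∀ a b c d → (a + b) + (c + d) ≡ (a + c) + (b + d)
    interchange = solve-∀

  sumTo-comm : ∀ m n (f : ℕ → ℕ → ℕ) →
    sumTo m (λ i → sumTo n (f i)) ≡ sumTo n (λ j → sumTo m (λ i → f i j))
  sumTo-comm zero    n f = sym (sumTo-zero n)
  sumTo-comm (suc m) n f = begin
    sumTo n (f 0) + sumTo m (λ i → sumTo n (f (suc i)))          ≡⟨ cong (sumTo n (f 0) +_) (sumTo-comm m n (f ∘ suc)) ⟩
    sumTo n (f 0) + sumTo n (λ j → sumTo m (λ i → f (suc i) j))  ≡⟨ sumTo-+ n (f 0) _ ⟨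
    sumTo n (λ j → f 0 j + sumTo m (λ i → f (suc i) j))          ∎
    where open ≡-Reasoning

  sumTo-suc : ∀ n f → sumTo (suc n) f ≡ sumTo n f + f n
  sumTo-suc zero    f = +-comm (f 0) 0
  sumTo-suc (suc n) f = trans (cong (f 0 +_) (sumTo-suc n (f ∘ suc))) (sym (+-assoc (f 0) _ _))

  sumTo-if : ∀ n b (f : ℕ → ℕ) → sumTo n (λ i → if b then f i else 0) ≡ (if b then sumTo n f else 0)
  sumTo-if n true  f = refl
  sumTo-if n false f = sumTo-zero n

  count-between : ∀ n h L →
    sumTo n (λ x → if (suc x ≤ᵇ h) ∧ (L ≤ᵇ suc x) then 1 else 0) ≡ (n ⊓ h) ∸ pred L
  count-between zero    h L = sym (0∸n≡0 (pred L))
  count-between (suc n) h L = begin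
    sumTo (suc n) χ              ≡⟨ sumTo-suc n χ ⟩
    sumTo n χ + χ n              ≡⟨ cong (_+ χ n) (count-between n h L) ⟩
    (n ⊓ h) ∸ pred L + χ n       ≡⟨ step (suc n ≤? h) (L ≤? suc n) ⟩
    (suc n ⊓ h) ∸ pred L         ∎
    where
    χ : ℕ → ℕ
    χ x = if (suc x ≤ᵇ h) ∧ (L ≤ᵇ suc x) then 1 else 0
    open ≡-Reasoning
    step : Dec (suc n ≤ h) → Dec (L ≤ suc n) → (n ⊓ h) ∸ pred L + χ n ≡ (suc n ⊓ h) ∸ pred L
    step (yes n<h) (yes L≤1+n) rewrite ≤ᵇ-true n<h | ≤ᵇ-true L≤1+n
                                     | m≤n⇒m⊓n≡m (<⇒≤ n<h) | m≤n⇒m⊓n≡m n<h = begin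
      n ∸ pred L + 1   ≡⟨ +-comm (n ∸ pred L) 1 ⟩
      1 + (n ∸ pred L) ≡⟨ +-∸-assoc 1 (pred-mono-≤ L≤1+n) ⟨
      suc n ∸ pred L   ∎
    step (yes n<h) (no L≰1+n) rewrite ≤ᵇ-true n<h | ≤ᵇ-false L≰1+n
                                    | m≤n⇒m⊓n≡m (<⇒≤ n<h) | m≤n⇒m⊓n≡m n<h
                                    | m≤n⇒m∸n≡0 (pred-mono-≤ (≰⇒> L≰1+n))
                                    | m≤n⇒m∸n≡0 (≤-trans (n≤1+n n) (pred-mono-≤ (≰⇒> L≰1+n))) = refl
    step (no n≮h) _ rewrite ≤ᵇ-false n≮h
                          | m≥n⇒m⊓n≡n (≤-pred (≰⇒> n≮h))
                          | m≥n⇒m⊓n≡n (≤-trans (≤-pred (≰⇒> n≮h)) (n≤1+n n)) = +-identityʳ _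

  -- G n is, by definition, ferrers n (heightG n).
  ferrers : ℕ → (ℕ → ℕ) → Diagram
  ferrers n h x y = (1 ≤ᵇ y) ∧ (y ≤ᵇ n) ∧ (1 ≤ᵇ x) ∧ (x ≤ᵇ h y)

  indicator-∧ : ∀ p a b → (if p ∧ (a ∧ b) then 1 else 0) ≡ (if b then (if p ∧ a then 1 else 0) else 0)
  indicator-∧ true  true  b     = refl
  indicator-∧ true  false true  = refl
  indicator-∧ true  false false = refl
  indicator-∧ false a     true  = refl
  indicator-∧ false a     false = refl

  nu-ferrers : ∀ n h d j → nu n (ferrers n h) d j ≡
    sumTo n (λ y → if j + 1 ≤ᵇ suc y then (n ⊓ h (suc y)) ∸ pred (d ∸ j) else 0)
  nu-ferrers n h d j = begin
    sum (concatMap (λ x → map (cell x) (applyUpTo suc n)) (applyUpTo suc n))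
      ≡⟨ sum-concatMap (λ x → map (cell x) (applyUpTo suc n)) (applyUpTo suc n) ⟩
    sum (map (λ x → sum (map (cell x) (applyUpTo suc n))) (applyUpTo suc n))
      ≡⟨ sum-map-applyUpTo suc (λ x → sum (map (cell x) (applyUpTo suc n))) n ⟩
    sumTo n (λ x → sum (map (cell (suc x)) (applyUpTo suc n)))
      ≡⟨ sumTo-cong n (λ x _ → sum-map-applyUpTo suc (cell (suc x)) n) ⟩
    sumTo n (λ x → sumTo n (λ y → cell (suc x) (suc y)))
      ≡⟨ sumTo-comm n n (λ x y → cell (suc x) (suc y)) ⟩
    sumTo n (λ y → sumTo n (λ x → cell (suc x) (suc y)))
      ≡⟨ sumTo-cong n column ⟩
    sumTo n (λ y → if j + 1 ≤ᵇ suc y then (n ⊓ h (suc y)) ∸ pred (d ∸ j) else 0) ∎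
    where
    open ≡-Reasoning
    cell : ℕ → ℕ → ℕ
    cell x y = if ferrers n h x y ∧ ((d ∸ j) ≤ᵇ x) ∧ ((j + 1) ≤ᵇ y) then 1 else 0
    column : ∀ y → y < n → sumTo n (λ x → cell (suc x) (suc y)) ≡
      (if j + 1 ≤ᵇ suc y then (n ⊓ h (suc y)) ∸ pred (d ∸ j) else 0)
    column y y<n = begin
      sumTo n (λ x → cell (suc x) (suc y))     ≡⟨ sumTo-cong n (λ x _ → split x) ⟩
      sumTo n (λ x → if b then χ x else 0)     ≡⟨ sumTo-if n b χ ⟩
      (if b then sumTo n χ else 0)
        ≡⟨ cong (if b then_else 0) (count-between n (h (suc y)) (d ∸ j)) ⟩
      (if b then (n ⊓ h (suc y)) ∸ pred (d ∸ j) else 0) ∎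
      where
      b = j + 1 ≤ᵇ suc y
      χ : ℕ → ℕ
      χ x = if (suc x ≤ᵇ h (suc y)) ∧ ((d ∸ j) ≤ᵇ suc x) then 1 else 0
      split : ∀ x → cell (suc x) (suc y) ≡ (if b then χ x else 0)
      split x rewrite <ᵇ-true y<n = indicator-∧ (suc x ≤ᵇ h (suc y)) _ b

module DiagramG where

  open BooleanComparisons
  open FerrersDiagrams
  open import Relation.Binary.PropositionalEquality
    using (refl; sym; trans; cong; cong₂; subst₂; module ≡-Reasoning)
  open import Data.Sum using (_⊎_; inj₁; inj₂)
  open import Relation.Nullary.Negation using (contradiction)
  open import Data.Nat using (_+_; _*_; s<s⁻¹; s≤s⁻¹)
  open import Data.Nat.Properties
    using (_<?_; ≤-trans; ≤-antisym; ≮⇒≥; <⇒≢; n≤1+n; n<1+n; m<n⇒m<1+n; m≤m+n; +-monoˡ-≤; +-monoʳ-<;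
           m≥n⇒m⊓n≡n; ⊓-idem)
  open import Data.Nat.Tactic.RingSolver using (solve-∀)

  heightG-middle : ∀ k y → 0 < y → y < 3 + k → heightG (4 + k) (suc y) ≡ 3 + k
  heightG-middle k (suc y) _ y<2+k rewrite ≡ᵇ-false (<⇒≢ (s<s⁻¹ y<2+k)) = refl

  heightG-last : ∀ k → heightG (4 + k) (4 + k) ≡ 1
  heightG-last k rewrite ≡ᵇ-refl k = refl

  columnG : ℕ → ℕ → ℕ → ℕ
  columnG k j y = if j + 1 ≤ᵇ suc y then ((4 + k) ⊓ heightG (4 + k) (suc y)) ∸ pred (3 ∸ j) else 0

  nu-G-columns : ∀ k j → j ≤ 2 → nu (4 + k) (G (4 + k)) 3 j ≡
    columnG k j 0 + (columnG k j 1 + (columnG k j 2 +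
      (k * ((3 + k) ∸ pred (3 ∸ j)) + (1 ∸ pred (3 ∸ j)))))
  nu-G-columns k j j≤2 = trans (nu-ferrers (4 + k) (heightG (4 + k)) 3 j)
    (cong (λ s → columnG k j 0 + (columnG k j 1 + (columnG k j 2 + s)))
      (trans (sumTo-suc k (columnG k j ∘ (3 +_))) (cong₂ _+_ middle last)))
    where
    j+1≤4+i : ∀ i → j + 1 ≤ 4 + i
    j+1≤4+i i = ≤-trans (+-monoˡ-≤ 1 j≤2) (m≤m+n 3 (suc i))
    middle : sumTo k (columnG k j ∘ (3 +_)) ≡ k * ((3 + k) ∸ pred (3 ∸ j))
    middle = trans (sumTo-cong k column-middle) (sumTo-const k _)
      where
      column-middle : ∀ i → i < k → columnG k j (3 + i) ≡ (3 + k) ∸ pred (3 ∸ j)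
      column-middle i i<k rewrite ≤ᵇ-true (j+1≤4+i i) | heightG-middle k (3 + i) z<s (+-monoʳ-< 3 i<k)
                                | m≥n⇒m⊓n≡n (n≤1+n (3 + k)) = refl
    last : columnG k j (3 + k) ≡ 1 ∸ pred (3 ∸ j)
    last rewrite ≤ᵇ-true (j+1≤4+i k) | heightG-last k = refl

  nu-G : ∀ k j → j ≤ 2 → nu (4 + k) (G (4 + k)) 3 j ≡ (2 + k) * (2 + k)
  nu-G k 0 j≤2 rewrite nu-G-columns k 0 j≤2 | ⊓-idem k | m≥n⇒m⊓n≡n (n≤1+n k) = arith k
    where
    arith : ∀ k → 2 + k + (1 + k + (1 + k + (k * (1 + k) + 0))) ≡ (2 + k) * (2 + k)
    arith = solve-∀
  nu-G k 1 j≤2 rewrite nu-G-columns k 1 j≤2 | m≥n⇒m⊓n≡n (n≤1+n k) = arith k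
    where
    arith : ∀ k → 0 + (2 + k + (2 + k + (k * (2 + k) + 0))) ≡ (2 + k) * (2 + k)
    arith = solve-∀
  nu-G k 2 j≤2 rewrite nu-G-columns k 2 j≤2 | m≥n⇒m⊓n≡n (n≤1+n k) = arith k
    where
    arith : ∀ k → 0 + (0 + (3 + k + (k * (3 + k) + 1))) ≡ (2 + k) * (2 + k)
    arith = solve-∀
  nu-G k (suc (suc (suc j))) (s≤s (s≤s ()))

  nuMin-G : ∀ k → nuMin (4 + k) (G (4 + k)) 3 ≡ (2 + k) * (2 + k)
  nuMin-G k = begin
    ν 0 ⊓ (ν 1 ⊓ (ν 2 ⊓ ν 0)) ≡⟨ cong₂ _⊓_ (nu-G k 0 z≤n) (cong₂ _⊓_ (nu-G k 1 (s≤s z≤n))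
                                   (cong₂ _⊓_ (nu-G k 2 (s≤s (s≤s z≤n))) (nu-G k 0 z≤n))) ⟩
    s ⊓ (s ⊓ (s ⊓ s))          ≡⟨ cong (λ t → s ⊓ (s ⊓ t)) (⊓-idem s) ⟩
    s ⊓ (s ⊓ s)                ≡⟨ cong (s ⊓_) (⊓-idem s) ⟩
    s ⊓ s                      ≡⟨ ⊓-idem s ⟩
    s                          ∎
    where
    open ≡-Reasoning
    ν : ℕ → ℕ
    ν = nu (4 + k) (G (4 + k)) 3
    s = (2 + k) * (2 + k)

  G-inner : ∀ k x y → x < 3 + k → y < 3 + k → G (4 + k) (suc x) (suc y) ≡ true
  G-inner k x zero    x<3+k _     rewrite <ᵇ-true (m<n⇒m<1+n x<3+k) = refl
  G-inner k x (suc y) x<3+k y<3+k rewrite heightG-middle k (suc y) z<s y<3+k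
                                        | <ᵇ-true (≤-trans (n≤1+n _) y<3+k) | <ᵇ-true x<3+k = refl

  G-bottom-left : ∀ k → G (4 + k) (4 + k) 1 ≡ true
  G-bottom-left k rewrite <ᵇ-true (n<1+n k) = refl

  G-top-right : ∀ k → G (4 + k) 1 (4 + k) ≡ true
  G-top-right k rewrite heightG-last k | <ᵇ-true (n<1+n k) = refl

  private
    NotInG : ℕ → ℕ → ℕ → Set
    NotInG k x y = G (4 + k) (suc x) (suc y) ≡ false

  G-outside : ∀ k x y → x < 4 + k → y < 4 + k → G (4 + k) (suc x) (suc y) ≡ false →
    (x ≡ 3 + k × y ≢ 0) ⊎ (y ≡ 3 + k × x ≢ 0)
  G-outside k x y x<4+k y<4+k outside with x <? 3 + k | y <? 3 + k
  ... | yes x<3+k | yes y<3+k = contradiction (trans (sym (G-inner k x y x<3+k y<3+k)) outside) λ ()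
  ... | no  x≮3+k | _         = inj₁ (x≡3+k , λ y≡0 →
          contradiction (trans (sym (G-bottom-left k)) (subst₂ (NotInG k) x≡3+k y≡0 outside)) λ ())
    where x≡3+k = ≤-antisym (s≤s⁻¹ x<4+k) (≮⇒≥ x≮3+k)
  ... | yes _     | no  y≮3+k = inj₂ (y≡3+k , λ x≡0 →
          contradiction (trans (sym (G-top-right k)) (subst₂ (NotInG k) x≡0 y≡3+k outside)) λ ())
    where y≡3+k = ≤-antisym (s≤s⁻¹ y<4+k) (≮⇒≥ y≮3+k)

module FiniteEnumeration {a r} {A : Set a} {_∼_ : A → A → Set r} (∼-refl : ∀ {x} → x ∼ x)
  (xs : List A) (complete : ∀ x → Any (x ∼_) xs) where

  any? : ∀ {p} {P : A → Set p} → (∀ {x y} → x ∼ y → P x → P y) → (∀ x → Dec (P x)) → Dec (∃ P)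
  any? resp P? =
    map′ Any.satisfied (λ (x , px) → Any.map (λ x∼y → resp x∼y px) (complete x)) (Any.any? P? xs)

  anyVector? : ∀ k {p} {P : Vector A k → Set p} → (∀ {α β} → (∀ t → α t ∼ β t) → P α → P β) →
    (∀ α → Dec (P α)) → Dec (∃ P)
  anyVector? zero    resp P? = map′ ([] ,_) (λ (α , pα) → resp (λ ()) pα) (P? [])
  anyVector? (suc k) {P = P} resp P? =
    map′ (λ (x , β , p) → x ∷ β , p) (λ (α , pα) → head α , tail α , resp head∷tail pα)
      (any? resp-head (λ x → anyVector? k (resp ∘ resp-tail) (P? ∘ (x ∷_))))
    where
    head∷tail : ∀ {α} t → α t ∼ (head α ∷ tail α) t
    head∷tail zero    = ∼-refl
    head∷tail (suc t) = ∼-refl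
    resp-tail : ∀ {x β γ} → (∀ t → β t ∼ γ t) → ∀ t → (x ∷ β) t ∼ (x ∷ γ) t
    resp-tail β∼γ zero    = ∼-refl
    resp-tail β∼γ (suc t) = β∼γ t
    resp-head : ∀ {x y} → x ∼ y → ∃ (P ∘ (x ∷_)) → ∃ (P ∘ (y ∷_))
    resp-head {x} {y} x∼y (β , p) = β , resp x∼y∷β p
      where
      x∼y∷β : ∀ t → (x ∷ β) t ∼ (y ∷ β) t
      x∼y∷β zero    = x∼y
      x∼y∷β (suc t) = ∼-refl

module Linear {c ℓ : Level} (F : FiniteField c ℓ) where

  open FiniteField F hiding (zero)
  import Relation.Binary.PropositionalEquality as ≡
  open LA F
  open import Algebra.Properties.Ring ring
    using (-‿distribˡ-*; -‿distribʳ-*; -1*x≈-x; -0#≈0#; +-inverseʳ-unique)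
  open import Algebra.Properties.Semiring.Sum semiring using (sum-cong-≋; ∑-distrib-+; *-distribˡ-sum)
    renaming (sum to ∑)
  open import Relation.Binary.Reasoning.Setoid setoid
  open import Data.Nat.Properties using (_≤?_; ≰⇒>; 1+n≰n)
  open import Data.List using (allFin)
  open import Data.List.Membership.Propositional.Properties using (∈-allFin)
  open import Relation.Nullary.Decidable using (_×-dec_; ¬?; decidable-stable)
  open import Data.Empty using (⊥-elim)

  x*y≈0∧y≉0⇒x≈0 : ∀ {x y} → x * y ≈ 0# → ¬ y ≈ 0# → x ≈ 0#
  x*y≈0∧y≉0⇒x≈0 {x} {y} xy≈0 y≉0 with inverse y y≉0
  ... | y⁻¹ , yy⁻¹≈1 = begin
    x              ≈⟨ *-identityʳ x ⟨
    x * 1#         ≈⟨ *-congˡ yy⁻¹≈1 ⟨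
    x * (y * y⁻¹)  ≈⟨ *-assoc x y y⁻¹ ⟨
    x * y * y⁻¹    ≈⟨ *-congʳ xy≈0 ⟩
    0# * y⁻¹       ≈⟨ zeroˡ y⁻¹ ⟩
    0#             ∎

  x≈0⇒x+y≈y : ∀ {x y} → x ≈ 0# → x + y ≈ y
  x≈0⇒x+y≈y {x} {y} x≈0 = trans (+-congʳ x≈0) (+-identityˡ y)

  sumF≡∑ : ∀ {k} (f : Fin k → Carrier) → sumF f ≡ ∑ f
  sumF≡∑ {zero}  f = ≡.refl
  sumF≡∑ {suc k} f = ≡.cong (f zero +_) (sumF≡∑ (f ∘ suc))

  sumF-cong : ∀ {k} {f g : Fin k → Carrier} → (∀ t → f t ≈ g t) → sumF f ≈ sumF g
  sumF-cong {f = f} {g} f≈g = begin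
    sumF f ≡⟨ sumF≡∑ f ⟩
    ∑ f    ≈⟨ sum-cong-≋ f≈g ⟩
    ∑ g    ≡⟨ sumF≡∑ g ⟨
    sumF g ∎

  sumF-zero : ∀ {k} {f : Fin k → Carrier} → (∀ t → f t ≈ 0#) → sumF f ≈ 0#
  sumF-zero {zero}  f≈0 = refl
  sumF-zero {suc k} f≈0 = trans (x≈0⇒x+y≈y (f≈0 zero)) (sumF-zero (f≈0 ∘ suc))

  sumF-+ : ∀ {k} (f g : Fin k → Carrier) → sumF (λ t → f t + g t) ≈ sumF f + sumF g
  sumF-+ f g = begin
    sumF (λ t → f t + g t) ≡⟨ sumF≡∑ (λ t → f t + g t) ⟩
    ∑ (λ t → f t + g t)    ≈⟨ ∑-distrib-+ f g ⟩
    ∑ f + ∑ g              ≡⟨ ≡.cong₂ _+_ (sumF≡∑ f) (sumF≡∑ g) ⟨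
    sumF f + sumF g        ∎

  sumF-*ˡ : ∀ {k} x (f : Fin k → Carrier) → sumF (λ t → x * f t) ≈ x * sumF f
  sumF-*ˡ x f = begin
    sumF (λ t → x * f t) ≡⟨ sumF≡∑ (λ t → x * f t) ⟩
    ∑ (λ t → x * f t)    ≈⟨ *-distribˡ-sum x f ⟨
    x * ∑ f              ≡⟨ ≡.cong (x *_) (sumF≡∑ f) ⟨
    x * sumF f           ∎

  sumF-single : ∀ {k} (f : Fin k → Carrier) (t : Fin k) → (∀ s → s ≢ t → f s ≈ 0#) → sumF f ≈ f t
  sumF-single f zero    f≈0 = trans (+-congˡ (sumF-zero (λ s → f≈0 (suc s) λ ()))) (+-identityʳ (f zero))
  sumF-single f (suc t) f≈0 = trans (x≈0⇒x+y≈y (f≈0 zero λ ()))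
                                    (sumF-single (f ∘ suc) t (λ s s≢t → f≈0 (suc s) (s≢t ∘ Fin.suc-injective)))

  x+y*z≈0⇒z≈-y⁻¹*x : ∀ {x y z y⁻¹} → y * y⁻¹ ≈ 1# → x + y * z ≈ 0# → z ≈ - y⁻¹ * x
  x+y*z≈0⇒z≈-y⁻¹*x {x} {y} {z} {y⁻¹} yy⁻¹≈1 x+yz≈0 = begin
    z              ≈⟨ *-identityˡ z ⟨
    1# * z         ≈⟨ *-congʳ (trans (*-comm y⁻¹ y) yy⁻¹≈1) ⟨
    y⁻¹ * y * z    ≈⟨ *-assoc y⁻¹ y z ⟩
    y⁻¹ * (y * z)  ≈⟨ *-congˡ (+-inverseʳ-unique x (y * z) x+yz≈0) ⟩
    y⁻¹ * - x      ≈⟨ -‿distribʳ-* y⁻¹ x ⟨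
    - (y⁻¹ * x)    ≈⟨ -‿distribˡ-* y⁻¹ x ⟩
    - y⁻¹ * x      ∎

  δ : ∀ {k} → Fin k → Fin k → Carrier
  δ s t = if does (s Fin.≟ t) then 1# else 0#

  δ-diag : ∀ {k} (s : Fin k) → δ s s ≈ 1#
  δ-diag s = reflexive (≡.cong (if_then 1# else 0#) (dec-true (s Fin.≟ s) ≡.refl))

  δ-off : ∀ {k} {s t : Fin k} → s ≢ t → δ s t ≈ 0#
  δ-off {s = s} {t} s≢t = reflexive (≡.cong (if_then 1# else 0#) (dec-false (s Fin.≟ t) s≢t))

  sumF-δ : ∀ {k} (s : Fin k) (w : Fin k → Carrier) → sumF (λ t → δ s t * w t) ≈ w s
  sumF-δ s w = begin
    sumF (λ t → δ s t * w t) ≈⟨ sumF-single _ s (λ t t≢s → trans (*-congʳ (δ-off (t≢s ∘ ≡.sym))) (zeroˡ _)) ⟩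
    δ s s * w s              ≈⟨ *-congʳ (δ-diag s) ⟩
    1# * w s                 ≈⟨ *-identityˡ (w s) ⟩
    w s                      ∎

  columns : ∀ {a b r} → Mat a b → (Fin r → Fin b) → Fin r → Fin a → Carrier
  columns M s t i = M i (s t)

  LinIndep-cong : ∀ {k a} {v w : Fin k → Fin a → Carrier} → (∀ t i → v t i ≈ w t i) →
    LinIndep v → LinIndep w
  LinIndep-cong v≈w indep α comb = indep α (λ i → trans (sumF-cong (λ t → *-congˡ (v≈w t i))) (comb i))

  LinIndep⇒nonzero : ∀ {k a} {v : Fin k → Fin a → Carrier} → LinIndep v → ∀ t → ¬ (∀ i → v t i ≈ 0#)
  LinIndep⇒nonzero {v = v} indep t vt≈0 =
    0≉1 (trans (sym (indep (δ t) (λ i → trans (sumF-δ t (λ s → v s i)) (vt≈0 i)) t)) (δ-diag t))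

  LinIndep⇒distinct : ∀ {k a} {v : Fin k → Fin a → Carrier} → LinIndep v →
    ∀ {s t} → s ≢ t → ¬ (∀ i → v s i ≈ v t i)
  LinIndep⇒distinct {k} {v = v} indep {s} {t} s≢t vs≈vt = 0≉1 (begin
    0#            ≈⟨ indep α combination s ⟨
    δ s s - δ t s ≈⟨ +-cong (δ-diag s) (-‿cong (δ-off (s≢t ∘ ≡.sym))) ⟩
    1# - 0#       ≈⟨ +-congˡ -0#≈0# ⟩
    1# + 0#       ≈⟨ +-identityʳ 1# ⟩
    1#            ∎)
    where
    α : Fin k → Carrier
    α r = δ s r - δ t r
    combination : ∀ i → sumF (λ r → α r * v r i) ≈ 0#
    combination i = begin
      sumF (λ r → α r * v r i)                               ≈⟨ sumF-cong (λ r → expand (δ s r) (δ t r) (v r i)) ⟩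
      sumF (λ r → δ s r * v r i + - 1# * (δ t r * v r i))   ≈⟨ sumF-+ {k} _ _ ⟩
      sumF (λ r → δ s r * v r i) + sumF (λ r → - 1# * (δ t r * v r i))
                                                            ≈⟨ +-congˡ (sumF-*ˡ {k} (- 1#) _) ⟩
      sumF (λ r → δ s r * v r i) + - 1# * sumF (λ r → δ t r * v r i)
                                                            ≈⟨ +-cong (sumF-δ s _) (*-congˡ (sumF-δ t _)) ⟩
      v s i + - 1# * v t i                                  ≈⟨ +-cong (vs≈vt i) (-1*x≈-x (v t i)) ⟩
      v t i - v t i                                         ≈⟨ -‿inverseʳ (v t i) ⟩
      0#                                                    ∎
      where
      expand : ∀ x y z → (x - y) * z ≈ x * z + - 1# * (y * z)
      expand x y z = trans (distribʳ z x (- y))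
                           (+-congˡ (trans (sym (-‿distribˡ-* y z)) (sym (-1*x≈-x (y * z)))))

  LinIndep-columns-≤ : ∀ {a b r} (M : Mat a b) (s : Fin r → Fin b) → LinIndep (columns M s) → r ≤ b
  LinIndep-columns-≤ {b = b} {r} M s indep with r ≤? b
  ... | yes r≤b = r≤b
  ... | no  r≰b with Fin.pigeonhole (≰⇒> r≰b) s
  ...   | t , t' , t<t' , st≡st' =
          ⊥-elim (LinIndep⇒distinct indep (Fin.<⇒≢ t<t') (λ i → reflexive (≡.cong (M i) st≡st')))

  extendByZero : ∀ {k m} → k ≤ m → (Fin k → Carrier) → Fin m → Carrier
  extendByZero z≤n       α t       = 0#
  extendByZero (s≤s k≤m) α zero    = α zero
  extendByZero (s≤s k≤m) α (suc t) = extendByZero k≤m (α ∘ suc) t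

  extendByZero-inject≤ : ∀ {k m} (k≤m : k ≤ m) α (t : Fin k) → extendByZero k≤m α (inject≤ t k≤m) ≡ α t
  extendByZero-inject≤ (s≤s k≤m) α zero    = ≡.refl
  extendByZero-inject≤ (s≤s k≤m) α (suc t) = extendByZero-inject≤ k≤m (α ∘ suc) t

  sumF-extendByZero : ∀ {k m} (k≤m : k ≤ m) α (w : Fin m → Carrier) →
    sumF (λ t → extendByZero k≤m α t * w t) ≈ sumF (λ t → α t * w (inject≤ t k≤m))
  sumF-extendByZero z≤n       α w = sumF-zero (λ t → zeroˡ (w t))
  sumF-extendByZero (s≤s k≤m) α w = +-congˡ (sumF-extendByZero k≤m (α ∘ suc) (w ∘ suc))

  LinIndep-inject≤ : ∀ {k m a} {v : Fin m → Fin a → Carrier} → LinIndep v → (k≤m : k ≤ m) →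
    LinIndep (λ t → v (inject≤ t k≤m))
  LinIndep-inject≤ {v = v} indep k≤m α comb t = ≡.subst (_≈ 0#) (extendByZero-inject≤ k≤m α t)
    (indep (extendByZero k≤m α) (λ i → trans (sumF-extendByZero k≤m α (λ t → v t i)) (comb i))
           (inject≤ t k≤m))

  LinIndep⇒≤rank : ∀ {a b m r} (M : Mat a b) (s : Fin m → Fin b) → LinIndep (columns M s) →
    HasRank M r → m ≤ r
  LinIndep⇒≤rank {m = m} {r} M s indep (_ , maximal) with m ≤? r
  ... | yes m≤r = m≤r
  ... | no  m≰r = ⊥-elim (maximal (λ t → s (inject≤ t (≰⇒> m≰r))) (LinIndep-inject≤ indep (≰⇒> m≰r)))

  Dependence : ∀ {k a} → (Fin k → Fin a → Carrier) → (Fin k → Carrier) → Set ℓ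
  Dependence v α = (∀ i → sumF (λ t → α t * v t i) ≈ 0#) × ¬ (∀ t → α t ≈ 0#)

  Dependence-resp : ∀ {k a} {v : Fin k → Fin a → Carrier} {α β} → (∀ t → α t ≈ β t) →
    Dependence v α → Dependence v β
  Dependence-resp α≈β (comb , α≉0) = (λ i → trans (sumF-cong (λ t → *-congʳ (sym (α≈β t)))) (comb i))
                                   , (λ β≈0 → α≉0 (λ t → trans (α≈β t) (β≈0 t)))

  Dependence? : ∀ {k a} (v : Fin k → Fin a → Carrier) α → Dec (Dependence v α)
  Dependence? v α = Fin.all? (λ i → sumF (λ t → α t * v t i) ≟ 0#) ×-dec ¬? (Fin.all? (λ t → α t ≟ 0#))

  LinIndep? : ∀ {k a} (v : Fin k → Fin a → Carrier) → Dec (LinIndep v)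
  LinIndep? {k} v with FiniteEnumeration.anyVector? refl elements complete k Dependence-resp (Dependence? v)
  ... | yes (α , comb , α≉0) = no (λ indep → α≉0 (indep α comb))
  ... | no  independent      = yes (λ α comb → decidable-stable (Fin.all? (λ t → α t ≟ 0#))
                                                               (λ α≉0 → independent (α , comb , α≉0)))

  independentColumns? : ∀ {a b} (M : Mat a b) r → Dec (∃ λ (s : Fin r → Fin b) → LinIndep (columns M s))
  independentColumns? {b = b} M r =
    FiniteEnumeration.anyVector? ≡.refl (allFin b) ∈-allFin r
      (λ s≗s' → LinIndep-cong (λ t i → reflexive (≡.cong (M i) (s≗s' t)))) (LinIndep? ∘ columns M)

  rank : ∀ {a b} (M : Mat a b) → ∃ (HasRank M)
  rank {b = b} M = search (suc b) (λ (s , indep) → 1+n≰n (LinIndep-columns-≤ M s indep))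
    where
    search : ∀ m → ¬ (∃ λ (s : Fin m → Fin b) → LinIndep (columns M s)) → ∃ (HasRank M)
    search zero    none = ⊥-elim (none ([] , λ α comb ()))
    search (suc m) none with independentColumns? M m
    ... | yes some  = m , some , λ s indep → none (s , indep)
    ... | no  none' = search m none'

  echelon⇒LinIndep : ∀ {k a} (v : Fin k → Fin a → Carrier) (pivot : Fin k → Fin a) →
    (∀ t → ¬ v t (pivot t) ≈ 0#) → (∀ {s t} → toℕ s < toℕ t → v t (pivot s) ≈ 0#) → LinIndep v
  echelon⇒LinIndep {suc k} v pivot pivot≉0 below α comb = λ where
      zero    → α₀≈0
      (suc t) → echelon⇒LinIndep (v ∘ suc) (pivot ∘ suc) (pivot≉0 ∘ suc) (λ s<t → below (s<s s<t))
                  (α ∘ suc) (λ i → trans (sym (x≈0⇒x+y≈y (α₀v₀≈0 i))) (comb i)) t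
    where
    α₀≈0 : α zero ≈ 0#
    α₀≈0 = x*y≈0∧y≉0⇒x≈0 (begin
      α zero * v zero (pivot zero)         ≈⟨ +-identityʳ _ ⟨
      α zero * v zero (pivot zero) + 0#    ≈⟨ +-congˡ (sumF-zero {k} (λ t → trans (*-congˡ (below z<s)) (zeroʳ _))) ⟨
      sumF (λ t → α t * v t (pivot zero))  ≈⟨ comb (pivot zero) ⟩
      0#                                   ∎) (pivot≉0 zero)
    α₀v₀≈0 : ∀ i → α zero * v zero i ≈ 0#
    α₀v₀≈0 i = trans (*-congʳ α₀≈0) (zeroˡ _)

module Padding {c ℓ : Level} (F : FiniteField c ℓ) where

  open FiniteField F hiding (zero)
  import Relation.Binary.PropositionalEquality as ≡
  open LA F
  open Linear F
  open import Data.Empty using (⊥-elim)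
  open import Data.Nat.Properties using (_<?_; ≮⇒≥; ≤⇒≯)
  open import Relation.Nullary.Negation using (contradiction)

  entry-fromℕ< : ∀ {a b x y} (M : Mat a b) (x<a : x < a) (y<b : y < b) →
    entry M (suc x) (suc y) ≡ M (fromℕ< x<a) (fromℕ< y<b)
  entry-fromℕ< {a} {b} {x} {y} M x<a y<b with x <? a | y <? b
  ... | yes _   | yes _   = ≡.refl
  ... | no  x≮a | _       = contradiction x<a x≮a
  ... | yes _   | no  y≮b = contradiction y<b y≮b

  entry-below : ∀ {a b x} (M : Mat a b) y → a ≤ x → entry M (suc x) (suc y) ≡ 0#
  entry-below {a} {b} {x} M y a≤x with x <? a | y <? b
  ... | yes x<a | yes _ = contradiction x<a (≤⇒≯ a≤x)
  ... | no  _   | _     = ≡.refl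
  ... | yes _   | no  _ = ≡.refl

  entry-right : ∀ {a b y} (M : Mat a b) x → b ≤ y → entry M (suc x) (suc y) ≡ 0#
  entry-right {a} {b} {y} M x b≤y with x <? a | y <? b
  ... | yes _ | yes y<b = contradiction y<b (≤⇒≯ b≤y)
  ... | no  _ | _       = ≡.refl
  ... | yes _ | no  _   = ≡.refl

  entry-inside : ∀ {a b} (M : Mat a b) i j → entry M (suc (toℕ i)) (suc (toℕ j)) ≡ M i j
  entry-inside M i j = ≡.trans (entry-fromℕ< M (Fin.toℕ<n i) (Fin.toℕ<n j))
                               (≡.cong₂ M (Fin.fromℕ<-toℕ i _) (Fin.fromℕ<-toℕ j _))

  entry-sumF : ∀ {a b K} {M : Mat a b} (β : Fin K → Carrier) (N : Fin K → Mat a b) →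
    (∀ i j → M i j ≈ sumF (λ t → β t * N t i j)) →
    ∀ x y → entry M x y ≈ sumF (λ t → β t * entry (N t) x y)
  entry-sumF β N M≈ zero    y       = sym (sumF-zero (λ t → zeroʳ (β t)))
  entry-sumF β N M≈ (suc x) zero    = sym (sumF-zero (λ t → zeroʳ (β t)))
  entry-sumF {a} {b} β N M≈ (suc x) (suc y) with x <? a | y <? b
  ... | yes x<a | yes y<b = M≈ (fromℕ< x<a) (fromℕ< y<b)
  ... | no  _   | _       = sym (sumF-zero (λ t → zeroʳ (β t)))
  ... | yes _   | no  _   = sym (sumF-zero (λ t → zeroʳ (β t)))

  entry-*ˡ : ∀ {a b} z (M : Mat a b) x y → entry (λ i j → z * M i j) x y ≈ z * entry M x y
  entry-*ˡ z M zero    y       = sym (zeroʳ z)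
  entry-*ˡ z M (suc x) zero    = sym (zeroʳ z)
  entry-*ˡ {a} {b} z M (suc x) (suc y) with x <? a | y <? b
  ... | yes _ | yes _ = refl
  ... | no  _ | _     = sym (zeroʳ z)
  ... | yes _ | no  _ = sym (zeroʳ z)

  pad-inject≤ : ∀ {a b n} (M : Mat a b) (a≤n : a ≤ n) (b≤n : b ≤ n) i j →
    pad n M (inject≤ i a≤n) (inject≤ j b≤n) ≡ M i j
  pad-inject≤ M a≤n b≤n i j = ≡.trans (≡.cong₂ (λ x y → entry M (suc x) (suc y))
                                                (Fin.toℕ-inject≤ i a≤n) (Fin.toℕ-inject≤ j b≤n))
                                      (entry-inside M i j)

  LinIndep-pad : ∀ {a b n r} (M : Mat a b) (a≤n : a ≤ n) (b≤n : b ≤ n) (s : Fin r → Fin b) →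
    LinIndep (columns M s) → LinIndep (columns (pad n M) (λ t → inject≤ (s t) b≤n))
  LinIndep-pad M a≤n b≤n s indep α comb = indep α (λ i →
    trans (sumF-cong (λ t → *-congˡ (reflexive (≡.sym (pad-inject≤ M a≤n b≤n i (s t))))))
          (comb (inject≤ i a≤n)))

  LinIndep-unpad : ∀ {a b n r} (M : Mat a b) (s : Fin r → Fin n) →
    LinIndep (columns (pad n M) s) → ∃ λ (s' : Fin r → Fin b) → LinIndep (columns M s')
  LinIndep-unpad {a} {b} {n} {r} M s indep = s' , indep'
    where
    inside : ∀ t → toℕ (s t) < b
    inside t with toℕ (s t) <? b
    ... | yes st<b = st<b
    ... | no  st≮b =
      ⊥-elim (LinIndep⇒nonzero indep t (λ i → reflexive (entry-right M (toℕ i) (≮⇒≥ st≮b))))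
    s' : Fin r → Fin b
    s' t = fromℕ< (inside t)
    indep' : LinIndep (columns M s')
    indep' α comb = indep α row
      where
      row : ∀ i → sumF (λ t → α t * pad n M i (s t)) ≈ 0#
      row i = by-cases (toℕ i <? a)
        where
        by-cases : Dec (toℕ i < a) → sumF (λ t → α t * pad n M i (s t)) ≈ 0#
        by-cases (yes i<a) = trans (sumF-cong (λ t → *-congˡ (reflexive (entry-fromℕ< M i<a (inside t)))))
                                   (comb (fromℕ< i<a))
        by-cases (no  i≮a) = sumF-zero (λ t → trans (*-congˡ (reflexive (entry-below M (toℕ (s t)) (≮⇒≥ i≮a))))
                                                    (zeroʳ (α t)))

  HasRank-pad : ∀ {a b n r} (M : Mat a b) → a ≤ n → b ≤ n → HasRank M r → HasRank (pad n M) r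
  HasRank-pad M a≤n b≤n ((s , indep) , maximal) =
      (_ , LinIndep-pad M a≤n b≤n s indep)
    , (λ s' indep' → let (s'' , indep'') = LinIndep-unpad M s' indep' in maximal s'' indep'')

  HasRank-cong : ∀ {a b r} {M N : Mat a b} → (∀ i j → M i j ≈ N i j) → HasRank M r → HasRank N r
  HasRank-cong M≈N ((s , indep) , maximal) =
      (s , LinIndep-cong (λ t i → M≈N i (s t)) indep)
    , (λ s' indep' → maximal s' (LinIndep-cong (λ t i → sym (M≈N i (s' t))) indep'))

module SumCodes {c ℓ : Level} (F : FiniteField c ℓ) where

  open FiniteField F hiding (zero)
  import Relation.Binary.PropositionalEquality as ≡
  open LA F
  open Linear F
  open Padding F
  open import Relation.Binary.Reasoning.Setoid setoid

  IsBasis : ∀ {K a b ℓ'} → (Fin K → Mat a b) → (Mat a b → Set ℓ') → Set (c ⊔ ℓ ⊔ ℓ')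
  IsBasis B C = LinIndepMat B × (∀ M → C M → InSpan B M) × (∀ M → InSpan B M → C M)

  InSpan-*ˡ : ∀ {K a b} {B : Fin K → Mat a b} {M} x → InSpan B M → InSpan B (λ i j → x * M i j)
  InSpan-*ˡ {K} {B = B} x (β , M≈) = (λ t → x * β t) , λ i j → begin
    x * _                              ≈⟨ *-congˡ (M≈ i j) ⟩
    x * sumF (λ t → β t * B t i j)     ≈⟨ sumF-*ˡ {K} x _ ⟨
    sumF (λ t → x * (β t * B t i j))   ≈⟨ sumF-cong (λ t → *-assoc x (β t) (B t i j)) ⟨
    sumF (λ t → x * β t * B t i j)     ∎

  SumCode-basis : ∀ {K a b n ℓ'} {C₀ : Mat a b → Set ℓ'} {B : Fin K → Mat a b} (A : Mat n n) →
    a ≤ n → b ≤ n → IsBasis B C₀ → ∀ {i₀ j₀} → a ≤ toℕ i₀ → ¬ A i₀ j₀ ≈ 0# →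
    IsBasis (A ∷ pad n ∘ B) (SumCode n C₀ A)
  SumCode-basis {K} {a} {b} {n} {C₀ = C₀} {B} A a≤n b≤n (B-indep , C₀⊆span , span⊆C₀) {i₀} {j₀} a≤i₀ A≉0 =
    independent , sum⊆span , span⊆sum
    where
    independent : LinIndepMat (A ∷ pad n ∘ B)
    independent α comb = λ where
        zero    → α₀≈0
        (suc t) → B-indep (α ∘ suc) rest≈0 t
      where
      α₀≈0 : α zero ≈ 0#
      α₀≈0 = x*y≈0∧y≉0⇒x≈0 (begin
        α zero * A i₀ j₀                                               ≈⟨ +-identityʳ _ ⟨
        α zero * A i₀ j₀ + 0#                                          ≈⟨ +-congˡ (sumF-zero {K} pad≈0) ⟨
        α zero * A i₀ j₀ + sumF (λ t → α (suc t) * pad n (B t) i₀ j₀) ≈⟨ comb i₀ j₀ ⟩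
        0#                                                             ∎) A≉0
        where
        pad≈0 : ∀ t → α (suc t) * pad n (B t) i₀ j₀ ≈ 0#
        pad≈0 t = trans (*-congˡ (reflexive (entry-below (B t) (toℕ j₀) a≤i₀))) (zeroʳ (α (suc t)))
      rest≈0 : ∀ i j → sumF (λ t → α (suc t) * B t i j) ≈ 0#
      rest≈0 i j = begin
        sumF (λ t → α (suc t) * B t i j)                          ≈⟨ sumF-cong (λ t → *-congˡ (reflexive
                                                                       (≡.sym (pad-inject≤ (B t) a≤n b≤n i j)))) ⟩
        sumF (λ t → α (suc t) * pad n (B t) i' j')               ≈⟨ x≈0⇒x+y≈y (trans (*-congʳ α₀≈0) (zeroˡ _)) ⟨
        α zero * A i' j' + sumF (λ t → α (suc t) * pad n (B t) i' j') ≈⟨ comb i' j' ⟩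
        0#                                                        ∎
        where
        i' = inject≤ i a≤n
        j' = inject≤ j b≤n
    sum⊆span : ∀ X → SumCode n C₀ A X → InSpan (A ∷ pad n ∘ B) X
    sum⊆span X (M , λ' , M∈C₀ , X≈) with C₀⊆span M M∈C₀
    ... | β , M≈ = λ' ∷ β , λ i j → trans (X≈ i j)
                     (trans (+-comm _ _) (+-congˡ (entry-sumF β B M≈ (suc (toℕ i)) (suc (toℕ j)))))
    span⊆sum : ∀ X → InSpan (A ∷ pad n ∘ B) X → SumCode n C₀ A X
    span⊆sum X (α , X≈) = M , α zero , span⊆C₀ M (α ∘ suc , λ i j → refl) , λ i j →
        trans (X≈ i j) (trans (+-comm _ _)
          (+-congʳ (sym (entry-sumF (α ∘ suc) B (λ i j → refl) (suc (toℕ i)) (suc (toℕ j))))))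
      where
      M : Mat a b
      M i j = sumF (λ t → α (suc t) * B t i j)

module Construction {c ℓ : Level} (F : FiniteField c ℓ) (k : ℕ) (A' : LA.Mat F (2 ℕ.+ k) (2 ℕ.+ k)) where

  open FiniteField F hiding (zero)
  open LA F
  open Linear F
  open Padding F
  open SumCodes F
  open BooleanComparisons
  import Relation.Binary.PropositionalEquality as ≡
  open import Data.Nat.Properties using (n≮n; n≤1+n; ≤-reflexive)
  open import Data.Bool.Properties using (if-cong; ∧-zeroʳ)
  open import Data.Sum using (_⊎_; inj₁; inj₂)
  open import Relation.Nullary.Negation using (contradiction)
  open DiagramG using (G-outside)
  open import Data.Product using (proj₁; proj₂)
  open import Relation.Nullary.Decidable using (¬?; decidable-stable)

  n m : ℕ
  n = 4 ℕ.+ k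
  m = 3 ℕ.+ k

  A : Mat n n
  A = Amat n A'

  A-bottom-left : ∀ i → toℕ i ≡ m → A i zero ≡ 1#
  A-bottom-left i i≡m rewrite i≡m | ≡ᵇ-refl k = ≡.refl

  A-top-right : ∀ j → toℕ j ≡ m → A zero j ≡ 1#
  A-top-right j j≡m rewrite j≡m | ≡ᵇ-refl k = ≡.refl

  A-bottom : ∀ i j → toℕ i ≡ m → A i (suc j) ≡ 0#
  A-bottom i j i≡m rewrite i≡m | ≡ᵇ-refl k =
    if-cong (≡.cong (_∧ (toℕ j <ᵇ suc (suc k))) (<ᵇ-false (n≮n k)))

  A-right : ∀ i j → toℕ j ≡ m → A (suc i) j ≡ 0#
  A-right i j j≡m rewrite j≡m =
    ≡.trans (if-cong (∧-zeroʳ (toℕ i ≡ᵇ suc (suc k))))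
            (if-cong (≡.trans (≡.cong ((toℕ i <ᵇ suc (suc k)) ∧_) (<ᵇ-false (n≮n k))) (∧-zeroʳ _)))

  A-inner : ∀ p q → A (suc (inject₁ p)) (suc (inject₁ q)) ≡ A' p q
  A-inner p q rewrite Fin.toℕ-inject₁ p | Fin.toℕ-inject₁ q =
    ≡.trans (if-cong (∧-zeroʳ (toℕ p ≡ᵇ suc (suc k))))
            (≡.trans (if-cong (≡.cong₂ _∧_ (<ᵇ-true (Fin.toℕ<n p)) (<ᵇ-true (Fin.toℕ<n q))))
                     (entry-inside A' p q))

  A-outside : ∀ i j → (toℕ i ≡ m × toℕ j ≢ 0) ⊎ (toℕ j ≡ m × toℕ i ≢ 0) → A i j ≡ 0#
  A-outside i       zero    (inj₁ (_ , j≢0)) = contradiction ≡.refl j≢0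
  A-outside i       (suc j) (inj₁ (i≡m , _)) = A-bottom i j i≡m
  A-outside zero    j       (inj₂ (_ , i≢0)) = contradiction ≡.refl i≢0
  A-outside (suc i) j       (inj₂ (j≡m , _)) = A-right i j j≡m

  pad-bottom : ∀ (M : Mat m m) i j → toℕ i ≡ m → pad n M i j ≡ 0#
  pad-bottom M i j i≡m = entry-below M (toℕ j) (≤-reflexive (≡.sym i≡m))

  pad-right : ∀ (M : Mat m m) i j → toℕ j ≡ m → pad n M i j ≡ 0#
  pad-right M i j j≡m = entry-right M (toℕ i) (≤-reflexive (≡.sym j≡m))

  pad-outside : ∀ (M : Mat m m) i j → (toℕ i ≡ m × toℕ j ≢ 0) ⊎ (toℕ j ≡ m × toℕ i ≢ 0) →
    pad n M i j ≡ 0#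
  pad-outside M i j (inj₁ (i≡m , _)) = pad-bottom M i j i≡m
  pad-outside M i j (inj₂ (j≡m , _)) = pad-right M i j j≡m

  pad-inner : ∀ (M : Mat m m) p q → pad n M (suc (inject₁ p)) (suc (inject₁ q)) ≡ delFirst (2 ℕ.+ k) M p q
  pad-inner M p q = ≡.cong₂ (λ x y → entry M (2 ℕ.+ x) (2 ℕ.+ y)) (Fin.toℕ-inject₁ p) (Fin.toℕ-inject₁ q)

  module _ {ℓ'} {C₀ : Mat m m → Set ℓ'} where

    Code : Mat n n → Set (c ⊔ ℓ ⊔ ℓ')
    Code = SumCode n C₀ A

    module Entries {X : Mat n n} {M : Mat m m} {λ' : Carrier}
                   (X≈ : ∀ i j → X i j ≈ pad n M i j + λ' * A i j) where

      at : ∀ {i j P Q} → pad n M i j ≡ P → A i j ≡ Q → X i j ≈ P + λ' * Q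
      at {i} {j} pad≡P A≡Q = trans (X≈ i j) (reflexive (≡.cong₂ (λ P Q → P + λ' * Q) pad≡P A≡Q))

      zero-at : ∀ {i j} → pad n M i j ≡ 0# → A i j ≡ 0# → X i j ≈ 0#
      zero-at pad≡0 A≡0 = trans (at pad≡0 A≡0) (trans (+-identityˡ _) (zeroʳ λ'))

      λ-at : ∀ {i j} → pad n M i j ≡ 0# → A i j ≡ 1# → X i j ≈ λ'
      λ-at pad≡0 A≡1 = trans (at pad≡0 A≡1) (trans (+-identityˡ _) (*-identityʳ λ'))

    Code-inDiag : ∀ X → Code X → InDiag (G n) X
    Code-inDiag X (M , λ' , _ , X≈) i j outside = zero-at (pad-outside M i j position) (A-outside i j position)
      where
      open Entries X≈
      position = G-outside k (toℕ i) (toℕ j) (Fin.toℕ<n i) (Fin.toℕ<n j) outside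

    module _ {K} {B : Fin K → Mat m m} (B-basis : IsBasis B C₀)
             (A'∉C₀' : ¬ (∃ λ M → C₀ M × (∀ p q → A' p q ≈ delFirst (2 ℕ.+ k) M p q))) where

      private
        last : Fin n
        last = fromℕ m

        last≡m : toℕ last ≡ m
        last≡m = Fin.toℕ-fromℕ m

        innerBlock : Mat m m → Carrier → Fin (2 ℕ.+ k) → Fin (2 ℕ.+ k) → Carrier
        innerBlock M λ' p q = delFirst (2 ℕ.+ k) M p q + λ' * A' p q

      three-columns : ∀ {X M λ'} → C₀ M → ¬ λ' ≈ 0# → (∀ i j → X i j ≈ pad n M i j + λ' * A i j) →
        ∃ λ (s : Fin 3 → Fin n) → LinIndep (columns X s)
      three-columns {X} {M} {λ'} M∈C₀ λ'≉0 X≈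
        with Fin.any? (λ p → Fin.any? (λ q → ¬? (innerBlock M λ' p q ≟ 0#)))
      ... | yes (p , q , N≉0) = s , echelon⇒LinIndep (columns X s) pivot pivot≉0 below
        where
        open Entries X≈
        s pivot : Fin 3 → Fin n
        s     = zero ∷ suc (inject₁ q) ∷ last ∷ []
        pivot = last ∷ suc (inject₁ p) ∷ zero ∷ []
        pivot≉0 : ∀ t → ¬ X (pivot t) (s t) ≈ 0#
        pivot≉0 zero             = λ X≈0 → λ'≉0 (trans (sym (λ-at (pad-bottom M last zero last≡m)
                                                                (A-bottom-left last last≡m))) X≈0)
        pivot≉0 (suc zero)       = λ X≈0 → N≉0 (trans (sym (at (pad-inner M p q) (A-inner p q))) X≈0)
        pivot≉0 (suc (suc zero)) = λ X≈0 → λ'≉0 (trans (sym (λ-at (pad-right M zero last last≡m)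
                                                                (A-top-right last last≡m))) X≈0)
        below : ∀ {t t'} → toℕ t < toℕ t' → X (pivot t) (s t') ≈ 0#
        below {zero}     {suc zero}       _ =
          zero-at (pad-bottom M last (suc (inject₁ q)) last≡m) (A-bottom last (inject₁ q) last≡m)
        below {zero}     {suc (suc zero)} _ =
          zero-at (pad-bottom M last last last≡m) (A-bottom last (fromℕ (2 ℕ.+ k)) last≡m)
        below {suc zero} {suc (suc zero)} _ =
          zero-at (pad-right M (suc (inject₁ p)) last last≡m) (A-right (inject₁ p) last last≡m)
        below {zero}             {zero}           ()
        below {suc _}            {zero}           ()
        below {suc zero}         {suc zero}       (s<s ())
        below {suc (suc zero)}   {suc zero}       (s<s ())
        below {suc (suc zero)}   {suc (suc zero)} (s<s (s<s ()))
      ... | no none = contradiction (M' , M'∈C₀ , A'≈) A'∉C₀'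
        where
        λ⁻¹ = proj₁ (inverse λ' λ'≉0)
        M' : Mat m m
        M' i j = - λ⁻¹ * M i j
        M'∈C₀ : C₀ M'
        M'∈C₀ = let (_ , C₀⊆span , span⊆C₀) = B-basis
                in span⊆C₀ M' (InSpan-*ˡ (- λ⁻¹) (C₀⊆span M M∈C₀))
        A'≈ : ∀ p q → A' p q ≈ delFirst (2 ℕ.+ k) M' p q
        A'≈ p q = trans (x+y*z≈0⇒z≈-y⁻¹*x (proj₂ (inverse λ' λ'≉0))
                          (decidable-stable (innerBlock M λ' p q ≟ 0#) (λ N≉0 → none (p , q , N≉0))))
                        (sym (entry-*ˡ (- λ⁻¹) M (2 ℕ.+ toℕ p) (2 ℕ.+ toℕ q)))

      module _ (C₀-minRank : MinRankExactly 3 C₀) where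

        private
          m≤n : m ≤ n
          m≤n = n≤1+n m

        Code-minRank : MinRankExactly 3 Code
        Code-minRank = rank≥3 , rank3
          where
          rank≥3 : ∀ X → Code X → ¬ IsZero X → ∃ λ r → HasRank X r × (3 ≤ r)
          rank≥3 X (M , λ' , M∈C₀ , X≈) X≢0 with λ' ≟ 0#
          ... | yes λ'≈0 = let (r , rank-M , 3≤r) = proj₁ C₀-minRank M M∈C₀ M≢0
                           in r , HasRank-cong (sym ∘₂ X≈pad) (HasRank-pad M m≤n m≤n rank-M) , 3≤r
            where
            X≈pad : ∀ i j → X i j ≈ pad n M i j
            X≈pad i j = trans (X≈ i j) (trans (+-congˡ (trans (*-congʳ λ'≈0) (zeroˡ _))) (+-identityʳ _))
            M≢0 : ¬ IsZero M
            M≢0 M≈0 = X≢0 (λ i j → trans (X≈pad i j) (entry-sumF {K = 0} [] [] M≈0 (suc (toℕ i)) (suc (toℕ j))))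
          ... | no λ'≉0 = let (r , rank-X) = rank X
                              (s , indep) = three-columns M∈C₀ λ'≉0 X≈
                          in r , rank-X , LinIndep⇒≤rank X s indep rank-X
          rank3 : ∃ λ X → Code X × ¬ IsZero X × HasRank X 3
          rank3 = let (M , M∈C₀ , M≢0 , rank-M) = proj₂ C₀-minRank in
              pad n M
            , (M , 0# , M∈C₀ , λ i j → sym (trans (+-congˡ (zeroˡ _)) (+-identityʳ _)))
            , (λ pad≈0 → M≢0 (λ i j → trans (reflexive (≡.sym (pad-inject≤ M m≤n m≤n i j)))
                                           (pad≈0 (inject≤ i m≤n) (inject≤ j m≤n))))
            , HasRank-pad M m≤n m≤n rank-M

        Code-isCode : IsCode (G n) (suc K) 3 Code
        Code-isCode =
            (A ∷ pad n ∘ B , SumCode-basis A m≤n m≤n B-basis {last} {zero} (≤-reflexive (≡.sym last≡m)) A-corner≉0)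
          , Code-inDiag
          , Code-minRank
          where
          A-corner≉0 : ¬ A last zero ≈ 0#
          A-corner≉0 A≈0 = 0≉1 (trans (sym A≈0) (reflexive (A-bottom-left last last≡m)))

open import Data.Nat using (_*_)

theorem6p4 : ∀ {c ℓ ℓ' : Level} (F : FiniteField c ℓ) (n : ℕ) → 4 ≤ n →
    (C₀ : LA.Mat F (n ∸ 1) (n ∸ 1) → Set ℓ') →
    LA.IsMRD F (n ∸ 1) (n ∸ 1) 3 C₀ →
    (A' : LA.Mat F (n ∸ 2) (n ∸ 2)) →
    ¬ (∃ λ M → C₀ M × (∀ i j → FiniteField._≈_ F (A' i j) (LA.delFirst F (n ∸ 2) M i j))) →
    LA.IsCode F (G n) (nuMin n (G n) 3) 3 (LA.SumCode F n C₀ (LA.Amat F n A'))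
      × (nuMin n (G n) 3 ≡ (n ∸ 2) * (n ∸ 2))
theorem6p4 F _ (s≤s (s≤s (s≤s (s≤s (z≤n {k}))))) C₀ ((_ , B-basis) , _ , C₀-minRank) A' A'∉C₀' =
    subst (λ d → LA.IsCode F (G n) d 3 (LA.SumCode F n C₀ (LA.Amat F n A')))
          (trans mrd-dimension (sym (nuMin-G k)))
          (Construction.Code-isCode F k A' B-basis A'∉C₀' C₀-minRank)
  , nuMin-G k
  where
  open DiagramG using (nuMin-G)
  open import Data.Nat using (_+_)
  open import Data.Nat.Properties using (⊔-idem; ⊓-idem)
  open import Data.Nat.Tactic.RingSolver using (solve-∀)
  open import Relation.Binary.PropositionalEquality using (subst; trans; sym)
  n = 4 + k
  mrd-dimension : suc (((3 + k) ℕ.⊔ (3 + k)) * (((3 + k) ⊓ (3 + k)) ∸ 3 + 1)) ≡ (2 + k) * (2 + k)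
  mrd-dimension rewrite ⊔-idem k | ⊓-idem k = arith k
    where
    arith : ∀ j → suc ((3 + j) * (j + 1)) ≡ (2 + j) * (2 + j)
    arith = solve-∀
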